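{- Let $\psi:\mathbb{N}\to\mathbb{N}$ be an injective function, let $A=\psi(\mathbb{N})$, and let $\alpha\ge 1$ be an integer. For every $n\in\mathbb{N}$, \[ p^{A}(n)=\sum_{(N_0,N_1,N_2,\dots)}\ \prod_{j\ge 0} p^{A}_{\alpha}(N_j), \] where the sum runs over all sequences $(N_0,N_1,N_2,\dots)$ of non-negative integers (all but finitely many equal to $0$) satisfying $n=\sum_{i\ge 0}(\alpha+1)^{i}N_i$.
   Context: Here $\mathbb{N}=\{0,1,2,\dots\}$. A partition of $n$ into elements of $A$ is a multiset of positive integers belonging to $A$ whose sum is $n$. $p^{A}(n)$ is the number of partitions of $n$ into elements of $A$ (no restriction on repetitions), and $p^{A}_{\alpha}(n)$ is the number of partitions of $n$ into elements of $A$ in which each part occurs at most $\alpha$ times. By convention $p^{A}(0)=p^{A}_{\alpha}(0)=1$. -}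

module Defs where

open import Data.Nat using (ℕ; zero; suc; _+_; _*_; _^_)
open import Data.Fin using (Fin; toℕ)
open import Data.Product using (Σ; _×_; _,_; Σ-syntax)
open import Data.Sum using (_⊎_; inj₁; inj₂)
open import Data.Unit using (⊤; tt)
open import Data.Vec using (Vec; []; _∷_)
open import Relation.Binary.PropositionalEquality using (_≡_)

_∈Im_ : ℕ → (ℕ → ℕ) → Set
s ∈Im ψ = Σ ℕ λ i → ψ i ≡ s

-- Multiplicity of the part s in a partition into elements of A, no restriction:
-- either 0 (inj₁ tt), or a positive multiplicity suc k, allowed only when s ∈ A.
MultU : (ℕ → ℕ) → ℕ → Set
MultU ψ s = ⊤ ⊎ (s ∈Im ψ × ℕ)

valU : ∀ {ψ s} → MultU ψ s → ℕ
valU (inj₁ _) = 0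
valU (inj₂ (_ , k)) = suc k

-- Multiplicity of the part s when each part occurs at most α times:
-- either 0, or a multiplicity suc k with k < α (i.e. 1..α), allowed only when s ∈ A.
MultR : ℕ → (ℕ → ℕ) → ℕ → Set
MultR α ψ s = ⊤ ⊎ (s ∈Im ψ × Fin α)

valR : ∀ {α ψ s} → MultR α ψ s → ℕ
valR (inj₁ _) = 0
valR (inj₂ (_ , k)) = suc (toℕ k)

-- A table of multiplicities for the part sizes 1, 2, ..., m.
Table : (ℕ → Set) → ℕ → Set
Table M zero = ⊤
Table M (suc m) = Table M m × M (suc m)

tsum : {M : ℕ → Set} → (∀ {s} → M s → ℕ) → (m : ℕ) → Table M m → ℕ
tsum v zero _ = 0
tsum v (suc m) (t , x) = tsum v m t + suc m * v x

-- The set of partitions of n into elements of A = ψ(ℕ) (parts are positive, hence ≤ n);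
-- p^A(n) is its cardinality.
Partitions : (ℕ → ℕ) → ℕ → Set
Partitions ψ n = Σ[ t ∈ Table (MultU ψ) n ] tsum valU n t ≡ n

-- The set of partitions of n into elements of A, each part at most α times;
-- p^A_α(n) is its cardinality.
RPartitions : ℕ → (ℕ → ℕ) → ℕ → Set
RPartitions α ψ n = Σ[ t ∈ Table (MultR α ψ) n ] tsum valR n t ≡ n

weightedFrom : ℕ → ℕ → {k : ℕ} → Vec ℕ k → ℕ
weightedFrom b i [] = 0
weightedFrom b i (x ∷ xs) = b ^ i * x + weightedFrom b (suc i) xs

weighted : ℕ → {k : ℕ} → Vec ℕ k → ℕ
weighted b = weightedFrom b 0

-- Write every multiplicity in base α+1. For each i, the i-th digits of all multiplicities
-- form a partition of some N_i into elements of A in which each part occurs at most α times,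
-- and n = Σ (α+1)^i N_i; uniqueness of base-(α+1) expansions makes this a bijection.
-- As α ≥ 1 we have (α+1)^(n+1) > n, so only the digits at positions 0, …, n can be nonzero,
-- and a partition of N_i ≤ n has no part larger than N_i.
module Submission where

open import Defs
open import Data.Nat using (ℕ; zero; suc; _+_; _*_; _^_; _≤_; _<_; _≤′_; ≤′-refl; ≤′-step; z≤n; s≤s; NonZero)
open import Data.Nat.Properties
open import Data.Nat.DivMod using (_mod_; _/_; _%_; m≡m%n+[m/n]*n; m%n<n; [m+kn]%n≡m%n; m<n⇒m%n≡m)
open import Data.Nat.Tactic.RingSolver using (solve-∀)
open import Data.Fin using (Fin; toℕ; zero; suc)
open import Data.Fin.Properties using (toℕ<n; toℕ-fromℕ<; toℕ-injective)
open import Data.Product using (Σ; _×_; _,_; proj₁; proj₂; Σ-syntax)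
import Data.Product as Product
open import Data.Product.Function.Dependent.Propositional using (Σ-↔; congˡ)
open import Data.Product.Function.NonDependent.Propositional using (_×-↔_)
open import Data.Sum using (inj₁; inj₂)
open import Data.Unit using (tt)
open import Data.Unit.Polymorphic using (⊤)
open import Data.Vec using (Vec; []; _∷_; map; head; tail)
open import Data.Vec.Relation.Unary.All using (All; []; _∷_; reduce)
import Data.Vec.Relation.Unary.All as All
open import Function.Bundles using (_↔_; mk↔ₛ′; Inverse)
open import Function.Definitions using (Injective)
open import Function.Properties.Inverse using (↔-refl; ↔-sym; ↔-trans)
open import Function.Related.Propositional using (module EquationalReasoning)
open import Function.Related.TypeIsomorphisms using (Σ-assoc; ×-comm; ×-identityʳ)
open import Level using (0ℓ)
open import Relation.Binary.PropositionalEquality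
open import Relation.Nullary using (contradiction)

open Inverse using (to; from; strictlyInverseˡ; strictlyInverseʳ)

private
  variable
    A B R T : Set
    b c k m n N : ℕ

fibre-≡ : {f : A → ℕ} {a a′ : A} {p : f a ≡ n} {q : f a′ ≡ n} →
          a ≡ a′ → _≡_ {A = Σ A (λ a → f a ≡ n)} (a , p) (a′ , q)
fibre-≡ refl = cong (_ ,_) (≡-irrelevant _ _)

Σ-≡-cong : {g : A → ℕ} {h : B → ℕ} (I : A ↔ B) → (∀ b → g (from I b) ≡ h b) →
           Σ A (λ a → g a ≡ n) ↔ Σ B (λ b → h b ≡ n)
Σ-≡-cong {n = n} {g = g} {h} I g∘from≡h =
  ↔-sym (Σ-↔ (↔-sym I) (λ {b} → subst (λ x → (h b ≡ n) ↔ (x ≡ n)) (sym (g∘from≡h b)) ↔-refl))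

unique-zero↔⊤ : (v : A → ℕ) (z : A) → v z ≡ 0 → (∀ a → v a ≡ 0 → a ≡ z) →
                Σ A (λ a → v a ≡ 0) ↔ ⊤ {0ℓ}
unique-zero↔⊤ v z vz≡0 unique =
  mk↔ₛ′ _ (λ _ → z , vz≡0) (λ _ → refl) (λ (a , va≡0) → fibre-≡ (sym (unique a va≡0)))

high-part-vanishes : ∀ l c h → l + c * h ≡ n → n < c → h ≡ 0
high-part-vanishes l c zero    _ _   = refl
high-part-vanishes l c (suc h) e n<c =
  contradiction (≤-trans (m≤m*n c (suc h)) (≤-trans (m≤n+m (c * suc h) l) (≤-reflexive e))) (<⇒≱ n<c)

+-*-zeroʳ : ∀ l c → l + c * 0 ≡ l
+-*-zeroʳ l c = trans (cong (l +_) (*-zeroʳ c)) (+-identityʳ l)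

Σ-+*-split : {A B : Set} {g : A → ℕ} {h : B → ℕ} → n < c →
             Σ (A × B) (λ p → g (proj₁ p) + c * h (proj₂ p) ≡ n) ↔
             (Σ A (λ a → g a ≡ n) × Σ B (λ b → h b ≡ 0))
Σ-+*-split {n = n} {c} {A} {B} {g} {h} n<c = mk↔ₛ′ split join
  (λ _ → cong₂ _,_ (fibre-≡ refl) (fibre-≡ refl)) (λ _ → fibre-≡ refl)
  where
  split : Σ (A × B) (λ p → g (proj₁ p) + c * h (proj₂ p) ≡ n) → Σ A (λ a → g a ≡ n) × Σ B (λ b → h b ≡ 0)
  split ((a , b) , e) = (a , trans (sym (+-*-zeroʳ (g a) c)) (subst (λ x → g a + c * x ≡ n) hb≡0 e)) , (b , hb≡0)
    where hb≡0 = high-part-vanishes (g a) c (h b) e n<c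
  join : Σ A (λ a → g a ≡ n) × Σ B (λ b → h b ≡ 0) → Σ (A × B) (λ p → g (proj₁ p) + c * h (proj₂ p) ≡ n)
  join ((a , ga≡n) , (b , hb≡0)) = (a , b) , trans (cong (λ x → g a + c * x) hb≡0) (trans (+-*-zeroʳ (g a) c) ga≡n)

Σ-+*-drop : {g : A → ℕ} {h : B → ℕ} → n < c → Σ B (λ b → h b ≡ 0) ↔ ⊤ {0ℓ} →
            Σ (A × B) (λ p → g (proj₁ p) + c * h (proj₂ p) ≡ n) ↔ Σ A (λ a → g a ≡ n)
Σ-+*-drop n<c zero↔⊤ = ↔-trans (Σ-+*-split n<c) (↔-trans (↔-refl ×-↔ zero↔⊤) (×-identityʳ 0ℓ _))

All-↔ : {P Q : A → Set} {xs : Vec A k} → All (λ x → P x ↔ Q x) xs → All P xs ↔ All Q xs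
All-↔ []       = mk↔ₛ′ (λ { [] → [] }) (λ { [] → [] }) (λ { [] → refl }) (λ { [] → refl })
All-↔ (I ∷ Is) = mk↔ₛ′
  (λ { (p ∷ ps) → to I p ∷ to (All-↔ Is) ps })
  (λ { (q ∷ qs) → from I q ∷ from (All-↔ Is) qs })
  (λ { (q ∷ qs) → cong₂ _∷_ (strictlyInverseˡ I q) (strictlyInverseˡ (All-↔ Is) qs) })
  (λ { (p ∷ ps) → cong₂ _∷_ (strictlyInverseʳ I p) (strictlyInverseʳ (All-↔ Is) ps) })

module _ (f : T → ℕ) where

  Fibre : ℕ → Set
  Fibre N = Σ T (λ t → f t ≡ N)

  toFibres : Vec T k → Σ (Vec ℕ k) (All Fibre)
  toFibres []       = [] , []
  toFibres (t ∷ ts) = Product.map (f t ∷_) ((t , refl) ∷_) (toFibres ts)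

  map-reduce : {Ns : Vec ℕ k} (qs : All Fibre Ns) → map f (reduce proj₁ qs) ≡ Ns
  map-reduce []                = refl
  map-reduce ((t , refl) ∷ qs) = cong (f t ∷_) (map-reduce qs)

  toFibres-reduce : {Ns : Vec ℕ k} (qs : All Fibre Ns) → toFibres (reduce proj₁ qs) ≡ (Ns , qs)
  toFibres-reduce []              = refl
  toFibres-reduce ((t , refl) ∷ qs) = cong (Product.map (f t ∷_) ((t , refl) ∷_)) (toFibres-reduce qs)

  reduce-toFibres : (ts : Vec T k) → reduce proj₁ (proj₂ (toFibres ts)) ≡ ts
  reduce-toFibres []       = refl
  reduce-toFibres (t ∷ ts) = cong (t ∷_) (reduce-toFibres ts)

  Vec↔Σ-All-Fibre : Vec T k ↔ Σ (Vec ℕ k) (All Fibre)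
  Vec↔Σ-All-Fibre = mk↔ₛ′ toFibres (λ (_ , qs) → reduce proj₁ qs)
    (λ (_ , qs) → toFibres-reduce qs) reduce-toFibres

  Σ-map↔Σ-All-Fibre : (W : Vec ℕ k → ℕ) →
    Σ (Vec T k) (λ ts → W (map f ts) ≡ n) ↔ (Σ[ Ns ∈ Vec ℕ k ] (W Ns ≡ n × All Fibre Ns))
  Σ-map↔Σ-All-Fibre W =
    ↔-trans (Σ-≡-cong Vec↔Σ-All-Fibre (λ (_ , qs) → cong W (map-reduce qs)))
            (↔-trans Σ-assoc (congˡ (×-comm _ _)))

module _ {M : ℕ → Set} (val : ∀ {s} → M s → ℕ)
         (zero-part : ∀ {s} → Σ (M s) (λ x → val x ≡ 0) ↔ ⊤ {0ℓ}) where

  tsum≡0↔⊤ : ∀ m → Σ (Table M m) (λ t → tsum val m t ≡ 0) ↔ ⊤ {0ℓ}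
  tsum≡0↔⊤ zero    = unique-zero↔⊤ (tsum {M = M} val zero) tt refl (λ _ _ → refl)
  tsum≡0↔⊤ (suc m) = ↔-trans (Σ-+*-drop {c = suc m} (s≤s z≤n) zero-part) (tsum≡0↔⊤ m)

  tsum-resize : N ≤′ m → Σ (Table M m) (λ t → tsum val m t ≡ N) ↔ Σ (Table M N) (λ t → tsum val N t ≡ N)
  tsum-resize ≤′-refl                  = ↔-refl
  tsum-resize {m = suc m} (≤′-step N≤′m) = ↔-trans (Σ-+*-drop {c = suc m} (s≤s (≤′⇒≤ N≤′m)) zero-part) (tsum-resize N≤′m)

-- Reading g a as a number written in base b, split a = (r , a′) peels off its lowest digit r.
record DigitSplit (b : ℕ) {A R : Set} (f : R → ℕ) (g : A → ℕ) : Set where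
  field
    split  : A ↔ (R × A)
    weight : ∀ r a → g (from split (r , a)) ≡ f r + b * g a

open DigitSplit

×-interchange : {C D : Set} → ((A × B) × (C × D)) ↔ ((A × C) × (B × D))
×-interchange = mk↔ₛ′ (λ ((a , b) , (c , d)) → (a , c) , (b , d)) (λ ((a , c) , (b , d)) → (a , b) , (c , d))
  (λ _ → refl) (λ _ → refl)

+-*-interchange : ∀ L H l h b c → (L + b * H) + c * (l + b * h) ≡ (L + c * l) + b * (H + c * h)
+-*-interchange = solve-∀

digitSplit-table : {U R : ℕ → Set} {vU : ∀ {s} → U s → ℕ} {vR : ∀ {s} → R s → ℕ} →
                   (∀ {s} → DigitSplit b (vR {s}) (vU {s})) → ∀ m → DigitSplit b (tsum {R} vR m) (tsum {U} vU m)
digitSplit-table {b} D zero = record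
  { split  = mk↔ₛ′ (λ t → tt , t) proj₂ (λ _ → refl) (λ _ → refl)
  ; weight = λ _ _ → sym (*-zeroʳ b)
  }
digitSplit-table {b} {U} {R} {vU} {vR} D (suc m) = record
  { split  = ↔-trans (split rows ×-↔ split (D {suc m})) ×-interchange
  ; weight = λ (R , r) (H , h) → trans (cong₂ (λ x y → x + suc m * y) (weight rows R H) (weight D r h))
                                       (+-*-interchange (tsum vR m R) (tsum vU m H) (vR r) (vU h) b (suc m))
  }
  where
  rows : DigitSplit b (tsum {R} vR m) (tsum {U} vU m)
  rows = digitSplit-table D m

weightedFrom-suc : ∀ b i (xs : Vec ℕ k) → weightedFrom b (suc i) xs ≡ b * weightedFrom b i xs
weightedFrom-suc b i []       = sym (*-zeroʳ b)
weightedFrom-suc b i (x ∷ xs) = begin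
  b * b ^ i * x + weightedFrom b (suc (suc i)) xs   ≡⟨ cong₂ _+_ (*-assoc b (b ^ i) x) (weightedFrom-suc b (suc i) xs) ⟩
  b * (b ^ i * x) + b * weightedFrom b (suc i) xs   ≡⟨ *-distribˡ-+ b (b ^ i * x) _ ⟨
  b * (b ^ i * x + weightedFrom b (suc i) xs)       ∎
  where open ≡-Reasoning

+-*-shift : ∀ x W h b c → x + b * (W + c * h) ≡ (1 * x + b * W) + (b * c) * h
+-*-shift = solve-∀

digitSplit-iterate : {f : R → ℕ} {g : A → ℕ} → DigitSplit b f g → ∀ k → DigitSplit (b ^ k) (λ rs → weighted b (map f rs)) g
digitSplit-iterate D zero = record
  { split  = mk↔ₛ′ ([] ,_) proj₂ (λ { ([] , _) → refl }) (λ _ → refl)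
  ; weight = λ { [] a → sym (*-identityˡ _) }
  }
digitSplit-iterate {R} {A} {b} {f} {g} D (suc k) = record
  { split  = ↔-trans (split D) (↔-trans (↔-refl ×-↔ split Dₖ) cons)
  ; weight = weight-suc
  }
  where
  Dₖ = digitSplit-iterate D k
  cons : (R × (Vec R k × A)) ↔ (Vec R (suc k) × A)
  cons = mk↔ₛ′ (λ (r , rs , a) → r ∷ rs , a) (λ (rs , a) → head rs , tail rs , a)
               (λ { (r ∷ rs , a) → refl }) (λ _ → refl)
  weight-suc : ∀ rs a → g (from (split D) (head rs , from (split Dₖ) (tail rs , a))) ≡
                        weighted b (map f rs) + b ^ suc k * g a
  weight-suc (r ∷ rs) a = begin
    g (from (split D) (r , from (split Dₖ) (rs , a)))    ≡⟨ weight D r _ ⟩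
    f r + b * g (from (split Dₖ) (rs , a))               ≡⟨ cong (λ x → f r + b * x) (weight Dₖ rs a) ⟩
    f r + b * (weighted b (map f rs) + b ^ k * g a)      ≡⟨ +-*-shift (f r) _ (g a) b (b ^ k) ⟩
    1 * f r + b * weighted b (map f rs) + b ^ suc k * g a ≡⟨ cong (λ x → 1 * f r + x + b ^ suc k * g a) (weightedFrom-suc b 0 (map f rs)) ⟨
    weighted b (map f (r ∷ rs)) + b ^ suc k * g a        ∎
    where open ≡-Reasoning

module _ (b : ℕ) .{{_ : NonZero b}} where

  divMod-spec : ∀ v → toℕ (v mod b) + b * (v / b) ≡ v
  divMod-spec v = begin
    toℕ (v mod b) + b * (v / b) ≡⟨ cong₂ _+_ (toℕ-fromℕ< (m%n<n v b)) (*-comm b (v / b)) ⟩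
    v % b + v / b * b           ≡⟨ m≡m%n+[m/n]*n v b ⟨
    v                           ∎
    where open ≡-Reasoning

  mod-unique : ∀ (d : Fin b) q → (toℕ d + b * q) mod b ≡ d
  mod-unique d q = toℕ-injective (begin
    toℕ ((toℕ d + b * q) mod b) ≡⟨ toℕ-fromℕ< _ ⟩
    (toℕ d + b * q) % b         ≡⟨ cong (λ x → (toℕ d + x) % b) (*-comm b q) ⟩
    (toℕ d + q * b) % b         ≡⟨ [m+kn]%n≡m%n (toℕ d) q b ⟩
    toℕ d % b                   ≡⟨ m<n⇒m%n≡m (toℕ<n d) ⟩
    toℕ d                       ∎)
    where open ≡-Reasoning

  div-unique : ∀ (d : Fin b) q → (toℕ d + b * q) / b ≡ q
  div-unique d q = *-cancelˡ-≡ _ q b (+-cancelˡ-≡ (toℕ d) _ _ (begin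
    toℕ d + b * (v / b)         ≡⟨ cong (λ r → toℕ r + b * (v / b)) (mod-unique d q) ⟨
    toℕ (v mod b) + b * (v / b) ≡⟨ divMod-spec v ⟩
    toℕ d + b * q               ∎))
    where
    open ≡-Reasoning
    v = toℕ d + b * q

  ℕ↔Fin×ℕ : ℕ ↔ (Fin b × ℕ)
  ℕ↔Fin×ℕ = mk↔ₛ′ (λ v → v mod b , v / b) (λ (d , q) → toℕ d + b * q)
    (λ (d , q) → cong₂ _,_ (mod-unique d q) (div-unique d q)) divMod-spec

module _ {ψ : ℕ → ℕ} (ψ-injective : Injective _≡_ _≡_ ψ) {s : ℕ} where

  ∈Im-irrelevant : (p q : s ∈Im ψ) → p ≡ q
  ∈Im-irrelevant (i , ψi≡s) (j , ψj≡s) with ψ-injective (trans ψi≡s (sym ψj≡s))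
  ... | refl = cong (i ,_) (≡-irrelevant ψi≡s ψj≡s)

  multU : s ∈Im ψ → ℕ → MultU ψ s
  multU p zero    = inj₁ tt
  multU p (suc k) = inj₂ (p , k)

  valU-multU : ∀ p v → valU (multU p v) ≡ v
  valU-multU p zero    = refl
  valU-multU p (suc v) = refl

  multU-valU : ∀ p u → multU p (valU u) ≡ u
  multU-valU p (inj₁ tt)       = refl
  multU-valU p (inj₂ (p′ , k)) = cong (λ q → inj₂ (q , k)) (∈Im-irrelevant p p′)

  valU≡0↔⊤ : Σ (MultU ψ s) (λ u → valU u ≡ 0) ↔ ⊤ {0ℓ}
  valU≡0↔⊤ = unique-zero↔⊤ valU (inj₁ tt) refl λ { (inj₁ tt) _ → refl ; (inj₂ _) () }

  module _ (α : ℕ) where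

    valR≡0↔⊤ : Σ (MultR α ψ s) (λ r → valR r ≡ 0) ↔ ⊤ {0ℓ}
    valR≡0↔⊤ = unique-zero↔⊤ valR (inj₁ tt) refl λ { (inj₁ tt) _ → refl ; (inj₂ _) () }

    multR : s ∈Im ψ → Fin (suc α) → MultR α ψ s
    multR p zero    = inj₁ tt
    multR p (suc i) = inj₂ (p , i)

    valR-multR : ∀ p d → valR (multR p d) ≡ toℕ d
    valR-multR p zero    = refl
    valR-multR p (suc i) = refl

    digits : s ∈Im ψ → ℕ → MultR α ψ s × MultU ψ s
    digits p v = Product.map (multR p) (multU p) (to (ℕ↔Fin×ℕ (suc α)) v)

    -- Whether s ∈ A is undecidable, so the witness is taken from whichever multiplicity is
    -- positive; any two witnesses agree by ∈Im-irrelevant.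
    splitMult : MultU ψ s → MultR α ψ s × MultU ψ s
    splitMult (inj₁ tt)      = inj₁ tt , inj₁ tt
    splitMult (inj₂ (p , k)) = digits p (suc k)

    joinMult : MultR α ψ s × MultU ψ s → MultU ψ s
    joinMult (inj₁ tt , inj₁ tt)      = inj₁ tt
    joinMult (inj₁ tt , inj₂ (p , k)) = multU p (suc α * suc k)
    joinMult (inj₂ (p , i) , u)       = multU p (suc (toℕ i) + suc α * valU u)

    valU-joinMult : ∀ r u → valU (joinMult (r , u)) ≡ valR r + suc α * valU u
    valU-joinMult (inj₁ tt)      (inj₁ tt)      = sym (*-zeroʳ (suc α))
    valU-joinMult (inj₁ tt)      (inj₂ (p , k)) = valU-multU p _
    valU-joinMult (inj₂ (p , i)) u              = valU-multU p _

    joinMult≡multU : ∀ p r u → joinMult (r , u) ≡ multU p (valR r + suc α * valU u)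
    joinMult≡multU p r u = trans (sym (multU-valU p (joinMult (r , u)))) (cong (multU p) (valU-joinMult r u))

    splitMult-multU : ∀ p v → splitMult (multU p v) ≡ digits p v
    splitMult-multU p zero    = refl
    splitMult-multU p (suc v) = refl

    joinMult-splitMult : ∀ u → joinMult (splitMult u) ≡ u
    joinMult-splitMult (inj₁ tt)      = refl
    joinMult-splitMult (inj₂ (p , k)) = begin
      joinMult (multR p d , multU p q)                          ≡⟨ joinMult≡multU p (multR p d) (multU p q) ⟩
      multU p (valR (multR p d) + suc α * valU (multU p q))     ≡⟨ cong₂ (λ x y → multU p (x + suc α * y)) (valR-multR p d) (valU-multU p q) ⟩
      multU p (toℕ d + suc α * q)                               ≡⟨ cong (multU p) (strictlyInverseʳ (ℕ↔Fin×ℕ (suc α)) (suc k)) ⟩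
      multU p (suc k)                                           ∎
      where
      open ≡-Reasoning
      d = suc k mod suc α
      q = suc k / suc α

    splitMult-joinMult-at : ∀ p d u → splitMult (joinMult (multR p d , u)) ≡ (multR p d , u)
    splitMult-joinMult-at p d u = begin
      splitMult (joinMult (multR p d , u))                      ≡⟨ cong splitMult (joinMult≡multU p (multR p d) u) ⟩
      splitMult (multU p (valR (multR p d) + suc α * valU u))  ≡⟨ cong (λ x → splitMult (multU p (x + suc α * valU u))) (valR-multR p d) ⟩
      splitMult (multU p (toℕ d + suc α * valU u))             ≡⟨ splitMult-multU p _ ⟩
      digits p (toℕ d + suc α * valU u)                        ≡⟨ cong (Product.map (multR p) (multU p)) (strictlyInverseˡ (ℕ↔Fin×ℕ (suc α)) (d , valU u)) ⟩
      (multR p d , multU p (valU u))                            ≡⟨ cong (multR p d ,_) (multU-valU p u) ⟩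
      (multR p d , u)                                           ∎
      where open ≡-Reasoning

    splitMult-joinMult : ∀ x → splitMult (joinMult x) ≡ x
    splitMult-joinMult (inj₁ tt , inj₁ tt)      = refl
    splitMult-joinMult (inj₁ tt , inj₂ (p , k)) = splitMult-joinMult-at p zero (inj₂ (p , k))
    splitMult-joinMult (inj₂ (p , i) , u)       = splitMult-joinMult-at p (suc i) u

    digitSplit-mult : DigitSplit (suc α) (valR {α} {ψ} {s}) (valU {ψ} {s})
    digitSplit-mult = record
      { split  = mk↔ₛ′ splitMult joinMult splitMult-joinMult joinMult-splitMult
      ; weight = valU-joinMult
      }

entries-≤-weightedFrom : ∀ b .{{_ : NonZero b}} i (Ns : Vec ℕ k) → All (_≤ weightedFrom b i Ns) Ns
entries-≤-weightedFrom b i []       = []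
entries-≤-weightedFrom b i (N ∷ Ns) =
  ≤-trans (m≤n*m N (b ^ i) {{m^n≢0 b i}}) (m≤m+n _ _) ∷
  All.map (λ N′≤ → ≤-trans N′≤ (m≤n+m _ _)) (entries-≤-weightedFrom b (suc i) Ns)

entries-≤-weighted : ∀ b .{{_ : NonZero b}} {Ns : Vec ℕ k} → weighted b Ns ≡ n → All (_≤ n) Ns
entries-≤-weighted b {Ns} refl = entries-≤-weightedFrom b 0 Ns

n<b^n : 1 < b → ∀ n → n < b ^ n
n<b^n 1<b zero = s≤s z≤n
n<b^n {b@(suc _)} 1<b (suc n) = begin-strict
  suc n     ≤⟨ n<b^n 1<b n ⟩
  b ^ n     <⟨ m<m*n (b ^ n) b {{m^n≢0 b n}} 1<b ⟩
  b ^ n * b ≡⟨ *-comm (b ^ n) b ⟩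
  b ^ suc n ∎
  where open ≤-Reasoning

mainTheorem2 : (ψ : ℕ → ℕ) → Injective _≡_ _≡_ ψ → (α : ℕ) → 1 ≤ α → (n : ℕ) →
    Partitions ψ n ↔ (Σ[ Ns ∈ Vec ℕ (suc n) ] (weighted (suc α) Ns ≡ n × All (RPartitions α ψ) Ns))
mainTheorem2 ψ ψ-injective α 1≤α n = begin
  Partitions ψ n
    ↔⟨ Σ-≡-cong (split expansion) (λ (rs , t) → weight expansion rs t) ⟩
  Σ (Vec (Table (MultR α ψ) n) (suc n) × Table (MultU ψ) n)
    (λ p → weighted (suc α) (map (tsum valR n) (proj₁ p)) + suc α ^ suc n * tsum valU n (proj₂ p) ≡ n)
    ↔⟨ Σ-+*-drop (≤-<-trans (n≤1+n n) (n<b^n (s≤s 1≤α) (suc n))) (tsum≡0↔⊤ valU (valU≡0↔⊤ ψ-injective) n) ⟩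
  Σ (Vec (Table (MultR α ψ) n) (suc n)) (λ rs → weighted (suc α) (map (tsum valR n) rs) ≡ n)
    ↔⟨ Σ-map↔Σ-All-Fibre (tsum valR n) (weighted (suc α)) ⟩
  (Σ[ Ns ∈ Vec ℕ (suc n) ] (weighted (suc α) Ns ≡ n × All (Fibre (tsum valR n)) Ns))
    ↔⟨ congˡ (Σ-↔ ↔-refl (λ {w≡n} → All-↔ (All.map resize (entries-≤-weighted (suc α) w≡n)))) ⟩
  (Σ[ Ns ∈ Vec ℕ (suc n) ] (weighted (suc α) Ns ≡ n × All (RPartitions α ψ) Ns)) ∎
  where
  open EquationalReasoning
  expansion : DigitSplit (suc α ^ suc n) (λ rs → weighted (suc α) (map (tsum valR n) rs)) (tsum valU n)
  expansion = digitSplit-iterate (digitSplit-table (digitSplit-mult ψ-injective α) n) (suc n)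
  resize : ∀ {N} → N ≤ n → Fibre (tsum valR n) N ↔ RPartitions α ψ N
  resize N≤n = tsum-resize valR (valR≡0↔⊤ ψ-injective α) (≤⇒≤′ N≤n)
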